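{- Let $\mathbb{A}$ be a set of symbols and let $A=a_1a_2\dots a_m$ be a rainbow sequence with $a_i\in\mathbb{A}$ for all $i=1,\dots,m$. Let $r\ge 0$ and $1\le n_1<n_2<\dots<n_r<m$ be integers, and let $B^0,B^1,\dots,B^{r+1}$ be single symbols with $B^i\notin\mathbb{A}$ for all $i=0,1,\dots,r+1$ (the $B^i$ need not be distinct from each other). Then the sequence $$S=B^0\,A_{1,n_1}\,B^1\,A_{n_1+1,n_2}\,\dots\,B^r\,A_{n_r+1,m}\,B^{r+1}$$ is nonrepetitive.
   Context: A finite sequence $R=r_1r_2\dots r_{2n}$ ($n\ge1$) is a repetition if $r_i=r_{n+i}$ for all $i=1,\dots,n$. A sequence is repetitive if it contains a block of consecutive terms that is a repetition, and nonrepetitive otherwise. A sequence of length $k$ consisting of $k$ pairwise different symbols is called a rainbow sequence. For a sequence $A=a_1\dots a_m$ and $1\le k\le l\le m$, $A_{k,l}$ denotes the block $a_ka_{k+1}\dots a_l$. -}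

module Defs where

open import Data.Nat using (ℕ; zero; suc; _+_; _∸_; _<_; _≤_)
open import Data.List using (List; []; _∷_; _++_; take; drop; length)
open import Data.Vec using (Vec; []; _∷_)
open import Data.Product using (Σ; _×_; ∃-syntax)
open import Relation.Binary.PropositionalEquality using (_≡_; _≢_)
open import Relation.Nullary using (¬_)

-- A_{k,l} = a_k a_{k+1} … a_l  (1-indexed, consecutive block)
blk : {X : Set} → List X → ℕ → ℕ → List X
blk A k l = take (suc l ∸ k) (drop (k ∸ 1) A)

IsRepetition : {X : Set} → List X → Set
IsRepetition {X} R = Σ (List X) λ W → (W ≢ []) × (R ≡ W ++ W)

Repetitive : {X : Set} → List X → Set
Repetitive {X} S = ∃[ U ] ∃[ R ] ∃[ V ] (S ≡ U ++ R ++ V × IsRepetition R)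

Nonrepetitive : {X : Set} → List X → Set
Nonrepetitive S = ¬ Repetitive S

-- blocks A p (n_1 ∷ … ∷ n_r) m = A_{p+1,n_1}, A_{n_1+1,n_2}, …, A_{n_r+1,m}
blocks : {X : Set} → List X → ℕ → (ns : List ℕ) → ℕ → Vec (List X) (suc (length ns))
blocks A p [] m = blk A (suc p) m ∷ []
blocks A p (n ∷ ns) m = blk A (suc p) n ∷ blocks A n ns m

interleave : {X : Set} {k : ℕ} → Vec X (suc k) → Vec (List X) k → List X
interleave (b ∷ []) [] = b ∷ []
interleave (b ∷ bs@(_ ∷ _)) (c ∷ cs) = b ∷ (c ++ interleave bs cs)

-- Call the symbols of 𝔸 letters.  In S every letter occurs at most once, since the
-- letters of S are exactly those of the rainbow sequence A, and no two non-letters are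
-- adjacent, since the blocks A_{n_i+1,n_{i+1}} between consecutive B^i are nonempty.
-- A list with these two properties contains no square W W: one of the first two terms
-- of W (the only term, if |W| = 1, taken together with the first term of the second W)
-- is a letter, and it reappears in the second copy of W.
module Submission where

open import Defs
open import Data.Nat using (ℕ; zero; suc; _+_; _<_; _≤_; _∸_; s≤s)
open import Data.Nat.Properties using (m+[n∸m]≡n; <⇒≤; ≤-refl; ≤-trans; ≤-reflexive)
open import Data.List using (List; []; _∷_; _++_; concat; length; take; drop)
open import Data.List.Properties using (++-identityʳ; ++-assoc; take-all; length-drop; drop-drop; take++drop≡id)
open import Data.List.Membership.Propositional using (_∉_)
open import Data.List.Membership.Propositional.Properties using (∈-++⁺ʳ)
open import Data.List.Relation.Unary.All as All using (All; []; _∷_)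
open import Data.List.Relation.Unary.All.Properties using (take⁺; drop⁺)
open import Data.List.Relation.Unary.Any using (here; there)
open import Data.List.Relation.Unary.AllPairs as AllPairs using (AllPairs; []; _∷_)
open import Data.List.Relation.Unary.Unique.Propositional using (Unique)
open import Data.List.Relation.Unary.Linked as Linked using (Linked; []; [-]; _∷_)
open import Data.Vec using (Vec; []; _∷_; toList)
open import Data.Vec.Relation.Unary.All using () renaming (All to AllV; [] to []V; _∷_ to _∷V_)
open import Data.Product using (_×_; _,_; proj₁; proj₂)
open import Data.Sum using (_⊎_; inj₁; inj₂)
open import Data.Empty using (⊥)
open import Relation.Nullary using (¬_)
open import Relation.Binary.PropositionalEquality using (_≡_; _≢_; refl; sym; cong; subst; module ≡-Reasoning)

linked-∷⁺ : ∀ {X : Set} {R : X → X → Set} {x xs} → All (R x) xs → Linked R xs → Linked R (x ∷ xs)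
linked-∷⁺ []      []  = [-]
linked-∷⁺ (r ∷ _) Rxs = r ∷ Rxs

linked-++⁻ʳ : ∀ {X : Set} {R : X → X → Set} (xs : List X) {ys} → Linked R (xs ++ ys) → Linked R ys
linked-++⁻ʳ []       Rys   = Rys
linked-++⁻ʳ (_ ∷ xs) Rxsys = linked-++⁻ʳ xs (Linked.tail Rxsys)

allPairs-++⁻ʳ : ∀ {X : Set} {R : X → X → Set} (xs : List X) {ys} → AllPairs R (xs ++ ys) → AllPairs R ys
allPairs-++⁻ʳ []       Rys         = Rys
allPairs-++⁻ʳ (_ ∷ xs) (_ ∷ Rxsys) = allPairs-++⁻ʳ xs Rxsys

module _ {X : Set} (𝔸 : X → Set) where

  DistinctOn : List X → Set
  DistinctOn = AllPairs (λ x y → 𝔸 x → x ≢ y)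

  OutsidersIsolated : List X → Set
  OutsidersIsolated = Linked (λ x y → 𝔸 x ⊎ 𝔸 y)

  data Padded : List X → List X → Set where
    []   : Padded [] []
    keep : ∀ {x s a} → Padded s a → Padded (x ∷ s) (x ∷ a)
    pad  : ∀ {b s a} → ¬ 𝔸 b → Padded s a → Padded (b ∷ s) a

  distinctOn-head : ∀ {x xs} → DistinctOn (x ∷ xs) → 𝔸 x → x ∉ xs
  distinctOn-head (x≢xs ∷ _) 𝔸x x∈xs = All.lookup x≢xs x∈xs 𝔸x refl

  unique⇒distinctOn : ∀ {a} → Unique a → DistinctOn a
  unique⇒distinctOn = AllPairs.map (λ x≢y _ → x≢y)

  all-padded : ∀ {P : X → Set} {s a} → (∀ {y} → ¬ 𝔸 y → P y) → Padded s a → All P a → All P s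
  all-padded outside []         []         = []
  all-padded outside (keep s⊒a) (px ∷ pxs) = px ∷ all-padded outside s⊒a pxs
  all-padded outside (pad ¬𝔸b s⊒a) pxs     = outside ¬𝔸b ∷ all-padded outside s⊒a pxs

  distinctOn-padded : ∀ {s a} → Padded s a → DistinctOn a → DistinctOn s
  distinctOn-padded []             []          = []
  distinctOn-padded (keep s⊒a)     (px ∷ pxs)  =
    all-padded (λ ¬𝔸y 𝔸x x≡y → ¬𝔸y (subst 𝔸 x≡y 𝔸x)) s⊒a px ∷ distinctOn-padded s⊒a pxs
  distinctOn-padded (pad ¬𝔸b s⊒a) pxs        =
    All.tabulate (λ _ 𝔸b _ → ¬𝔸b 𝔸b) ∷ distinctOn-padded s⊒a pxs

  ¬square-prefix : ∀ w W V → DistinctOn ((w ∷ W) ++ (w ∷ W) ++ V)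
                     → OutsidersIsolated ((w ∷ W) ++ (w ∷ W) ++ V) → ⊥
  ¬square-prefix w []      V d (inj₁ 𝔸w ∷ _) = distinctOn-head d 𝔸w (here refl)
  ¬square-prefix w []      V d (inj₂ 𝔸w ∷ _) = distinctOn-head d 𝔸w (here refl)
  ¬square-prefix w (v ∷ W) V d (inj₁ 𝔸w ∷ _) = distinctOn-head d 𝔸w (∈-++⁺ʳ (v ∷ W) (here refl))
  ¬square-prefix w (v ∷ W) V (_ ∷ d) (inj₂ 𝔸v ∷ _) =
    distinctOn-head d 𝔸v (∈-++⁺ʳ W (there (here refl)))

  nonrepetitive : ∀ {s} → DistinctOn s → OutsidersIsolated s → Nonrepetitive s
  nonrepetitive d i (U , _ , V , refl , []      , W≢[] , refl) = W≢[] refl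
  nonrepetitive d i (U , _ , V , refl , (w ∷ W) , _    , refl) =
    ¬square-prefix w W V (subst DistinctOn assoc (allPairs-++⁻ʳ U d))
                             (subst OutsidersIsolated assoc (linked-++⁻ʳ U i))
    where
    assoc : ((w ∷ W) ++ (w ∷ W)) ++ V ≡ (w ∷ W) ++ (w ∷ W) ++ V
    assoc = ++-assoc (w ∷ W) (w ∷ W) V

  interleave-padded : ∀ {k} (Bs : Vec X (suc k)) (Cs : Vec (List X) k) → AllV (λ b → ¬ 𝔸 b) Bs
                    → Padded (interleave Bs Cs) (concat (toList Cs))
  interleave-padded (b ∷ [])           []       (¬𝔸b ∷V []V)  = pad ¬𝔸b []
  interleave-padded (b ∷ Bs@(_ ∷ _)) (C ∷ Cs) (¬𝔸b ∷V ¬𝔸Bs) =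
    pad ¬𝔸b (keep-++ C (interleave-padded Bs Cs ¬𝔸Bs))
    where
    keep-++ : ∀ {s a} C → Padded s a → Padded (C ++ s) (C ++ a)
    keep-++ []      s⊒a = s⊒a
    keep-++ (_ ∷ C) s⊒a = keep (keep-++ C s⊒a)

  letter-∷ : ∀ {x s} → 𝔸 x → OutsidersIsolated s → OutsidersIsolated (x ∷ s)
  letter-∷ {s = []}    𝔸x _ = [-]
  letter-∷ {s = _ ∷ _} 𝔸x i = inj₁ 𝔸x ∷ i

  interleave-isolated : ∀ {k} (Bs : Vec X (suc k)) (Cs : Vec (List X) k)
                      → AllV (_≢ []) Cs → AllV (All 𝔸) Cs → OutsidersIsolated (interleave Bs Cs)
  interleave-isolated (b ∷ []) [] []V []V = [-]
  interleave-isolated (b ∷ Bs@(_ ∷ _)) ([] ∷ Cs) (C≢[] ∷V _) _ with () ← C≢[] refl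
  interleave-isolated (b ∷ Bs@(_ ∷ _)) ((c ∷ C) ∷ Cs) (_ ∷V Cs≢[]) ((𝔸c ∷ 𝔸C) ∷V 𝔸Cs) =
    inj₂ 𝔸c ∷ letters-++ (𝔸c ∷ 𝔸C) (interleave-isolated Bs Cs Cs≢[] 𝔸Cs)
    where
    letters-++ : ∀ {C s} → All 𝔸 C → OutsidersIsolated s → OutsidersIsolated (C ++ s)
    letters-++ []         i = i
    letters-++ (𝔸x ∷ 𝔸C) i = letter-∷ 𝔸x (letters-++ 𝔸C i)

blk-nonempty : ∀ {X : Set} (A : List X) p n → p < n → n ≤ length A → blk A (suc p) n ≢ []
blk-nonempty (a ∷ A) zero    (suc n) _         _         ()
blk-nonempty (a ∷ A) (suc p) (suc n) (s≤s p<n) (s≤s n≤A) = blk-nonempty A p n p<n n≤A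

module _ {X : Set} (A : List X) where

  open ≡-Reasoning

  blocks-nonempty : ∀ p ns m → Linked _<_ (p ∷ ns) → All (_< m) ns → p < m → m ≤ length A
                  → AllV (_≢ []) (blocks A p ns m)
  blocks-nonempty p []       m _              []          p<m m≤A = blk-nonempty A p m p<m m≤A ∷V []V
  blocks-nonempty p (n ∷ ns) m (p<n ∷ sorted) (n<m ∷ ns<m) _  m≤A =
    blk-nonempty A p n p<n (≤-trans (<⇒≤ n<m) m≤A) ∷V blocks-nonempty n ns m sorted ns<m n<m m≤A

  blocks-all : ∀ {P : X → Set} → All P A → ∀ p ns m → AllV (All P) (blocks A p ns m)
  blocks-all PA p []       m = take⁺ _ (drop⁺ p PA) ∷V []V
  blocks-all PA p (n ∷ ns) m = take⁺ _ (drop⁺ p PA) ∷V blocks-all PA n ns m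

  concat-blocks : ∀ p ns → Linked _≤_ (p ∷ ns) → concat (toList (blocks A p ns (length A))) ≡ drop p A
  concat-blocks p [] _ = begin
    take (length A ∸ p) (drop p A) ++ []  ≡⟨ ++-identityʳ _ ⟩
    take (length A ∸ p) (drop p A)        ≡⟨ take-all _ _ (≤-reflexive (length-drop p A)) ⟩
    drop p A                              ∎
  concat-blocks p (n ∷ ns) (p≤n ∷ sorted) = begin
    take (n ∸ p) (drop p A) ++ concat (toList (blocks A n ns (length A)))
      ≡⟨ cong (take (n ∸ p) (drop p A) ++_) (concat-blocks n ns sorted) ⟩
    take (n ∸ p) (drop p A) ++ drop n A
      ≡⟨ cong (λ k → take (n ∸ p) (drop p A) ++ drop k A) (sym (m+[n∸m]≡n p≤n)) ⟩
    take (n ∸ p) (drop p A) ++ drop (p + (n ∸ p)) A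
      ≡⟨ cong (take (n ∸ p) (drop p A) ++_) (sym (drop-drop p (n ∸ p) A)) ⟩
    take (n ∸ p) (drop p A) ++ drop (n ∸ p) (drop p A)
      ≡⟨ take++drop≡id (n ∸ p) (drop p A) ⟩
    drop p A
      ∎

corollary2 : {X : Set} (𝔸 : X → Set) (A : List X)
    → All 𝔸 A → Unique A → 1 ≤ length A
    → (ns : List ℕ) → Linked _<_ ns → All (λ n → 1 ≤ n × n < length A) ns
    → (Bs : Vec X (suc (suc (length ns)))) → AllV (λ b → ¬ 𝔸 b) Bs
    → Nonrepetitive (interleave Bs (blocks A 0 ns (length A)))
corollary2 𝔸 A 𝔸A uniqueA 0<m ns sorted bounds Bs Bs∉𝔸 =
  nonrepetitive 𝔸 distinct isolated
  where
  sorted₀ : Linked _<_ (0 ∷ ns)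
  sorted₀ = linked-∷⁺ (All.map proj₁ bounds) sorted

  letters-of-S : Padded 𝔸 (interleave Bs (blocks A 0 ns (length A))) A
  letters-of-S = subst (Padded 𝔸 _) (concat-blocks A 0 ns (Linked.map <⇒≤ sorted₀))
                       (interleave-padded 𝔸 Bs _ Bs∉𝔸)

  distinct : DistinctOn 𝔸 (interleave Bs (blocks A 0 ns (length A)))
  distinct = distinctOn-padded 𝔸 letters-of-S (unique⇒distinctOn 𝔸 uniqueA)

  isolated : OutsidersIsolated 𝔸 (interleave Bs (blocks A 0 ns (length A)))
  isolated = interleave-isolated 𝔸 Bs _
               (blocks-nonempty A 0 ns (length A) sorted₀ (All.map proj₂ bounds) 0<m ≤-refl)
               (blocks-all A 𝔸A 0 ns (length A))
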